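{- Let $G$ be a threshold graph with binary string $b=0^{s_1}1^{t_1}0^{s_2}1^{t_2}\cdots0^{s_k}1^{t_k}$, where $k\ge1$ and all $s_i,t_i\ge1$, and let $Q_S$ be its Seidel quotient matrix. Then (i) if $t_k=1$, $-1$ is a simple eigenvalue of $Q_S$; (ii) if $t_k>1$, $-1$ is not an eigenvalue of $Q_S$.
   Context: A threshold graph is built from a single vertex by repeatedly adding either an isolated vertex or a dominating vertex; its binary string $\alpha_1\cdots\alpha_n$ has $\alpha_1=0$ and, for $i\ge2$, $\alpha_i=0$ if the $i$-th vertex was added isolated and $\alpha_i=1$ if added dominating (adjacent to all earlier vertices). The Seidel matrix is $S=J-I-2A$ ($A$ the adjacency matrix, $J$ all-ones). For the string $0^{s_1}1^{t_1}\cdots0^{s_k}1^{t_k}$, partition the vertices (in creation order) into $2k$ consecutive blocks $C_1,\dots,C_{2k}$ with $|C_{2j-1}|=s_j$ and $|C_{2j}|=t_j$. The Seidel quotient matrix $Q_S$ is the $2k\times 2k$ matrix whose $(i,j)$ entry is $\sum_{w\in C_j}S_{vw}$ for any $v\in C_i$ (independent of $v$). -}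

module Defs where

open import Data.Nat as ℕ using (ℕ; zero; suc; _≤_; _<_)
open import Data.Nat.Properties using (_<?_)
open import Data.Fin as Fin using (Fin; toℕ; fromℕ)
open import Data.Bool using (Bool; true; false; if_then_else_)
open import Data.List as List using (List; []; _∷_; _++_; replicate; concat; map; allFin; length)
open import Data.Rational as ℚ using (ℚ; 0ℚ; 1ℚ)
open import Data.Integer as ℤ using (ℤ)
open import Data.Product using (Σ; _×_; _,_)
open import Relation.Nullary using (¬_; does)
open import Relation.Binary.PropositionalEquality using (_≡_)

-- Binary string of the threshold graph  0^{s_1} 1^{t_1} ... 0^{s_k} 1^{t_k}
-- (false = 0 = isolated, true = 1 = dominating).  Vertices are numbered
-- 0,1,...,n-1 in creation order (vertex number v here is the paper's v+1).

binString : (k : ℕ) → (s t : Fin k → ℕ) → List Bool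
binString k s t = concat (map (λ j → replicate (s j) false ++ replicate (t j) true) (allFin k))

at : {A : Set} → A → List A → ℕ → A
at d []       _       = d
at d (x ∷ xs) zero    = x
at d (x ∷ xs) (suc i) = at d xs i

α : (k : ℕ) → (s t : Fin k → ℕ) → ℕ → Bool
α k s t v = at false (binString k s t) v

adj : (k : ℕ) → (s t : Fin k → ℕ) → ℕ → ℕ → Bool
adj k s t v w =
  if does (v <? w) then α k s t w
  else if does (w <? v) then α k s t v
  else false

-- Seidel matrix S = J - I - 2A, entries indexed by vertex numbers
seidel : (k : ℕ) → (s t : Fin k → ℕ) → ℕ → ℕ → ℤ
seidel k s t v w =
  if does (v ℕ.≟ w) then ℤ.0ℤ
  else if adj k s t v w then ℤ.-1ℤ
  else ℤ.1ℤ

-- Blocks C_1,...,C_{2k}: sizes s_1,t_1,...,s_k,t_k (block i is 0-based here)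

blockSizes : (k : ℕ) → (s t : Fin k → ℕ) → List ℕ
blockSizes k s t = concat (map (λ j → s j ∷ t j ∷ []) (allFin k))

blockSize : (k : ℕ) → (s t : Fin k → ℕ) → ℕ → ℕ
blockSize k s t i = at 0 (blockSizes k s t) i

sumFirst : ℕ → List ℕ → ℕ
sumFirst zero    _        = 0
sumFirst (suc i) []       = 0
sumFirst (suc i) (x ∷ xs) = x ℕ.+ sumFirst i xs

blockStart : (k : ℕ) → (s t : Fin k → ℕ) → ℕ → ℕ
blockStart k s t i = sumFirst i (blockSizes k s t)

rangeSum : (ℕ → ℤ) → ℕ → ℕ → ℤ
rangeSum f a zero      = ℤ.0ℤ
rangeSum f a (suc len) = f a ℤ.+ rangeSum f (suc a) len

Matrix : ℕ → Set
Matrix m = Fin m → Fin m → ℚ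

Vector : ℕ → Set
Vector m = Fin m → ℚ

-- Seidel quotient matrix Q_S (2k × 2k): entry (i,j) = Σ_{w ∈ C_j} S_{v w}
-- with v the first vertex of C_i (the value is independent of v ∈ C_i).
seidelQuotient : (k : ℕ) → (s t : Fin k → ℕ) → Matrix (2 ℕ.* k)
seidelQuotient k s t i j =
  ℚ._/_ (rangeSum (seidel k s t (blockStart k s t (toℕ i)))
                  (blockStart k s t (toℕ j))
                  (blockSize k s t (toℕ j))) 1

finSum : {m : ℕ} → (Fin m → ℚ) → ℚ
finSum {zero}  f = 0ℚ
finSum {suc m} f = f Fin.zero ℚ.+ finSum (λ i → f (Fin.suc i))

mulVec : {m : ℕ} → Matrix m → Vector m → Vector m
mulVec M v i = finSum (λ j → M i j ℚ.* v j)

identity : {m : ℕ} → Matrix m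
identity i j = if does (i Fin.≟ j) then 1ℚ else 0ℚ

shift : {m : ℕ} → Matrix m → ℚ → Matrix m
shift M λ' i j = M i j ℚ.- λ' ℚ.* identity i j

applyPow : {m : ℕ} → Matrix m → ℕ → Vector m → Vector m
applyPow M zero    v = v
applyPow M (suc r) v = mulVec M (applyPow M r v)

IsZeroVec : {m : ℕ} → Vector m → Set
IsZeroVec v = ∀ i → v i ≡ 0ℚ

IsEigenvalue : {m : ℕ} → ℚ → Matrix m → Set
IsEigenvalue {m} λ' M =
  Σ (Vector m) λ v → ¬ IsZeroVec v × (∀ i → mulVec M v i ≡ λ' ℚ.* v i)

-- λ is a simple eigenvalue of M (algebraic multiplicity one): there is an
-- eigenvector v for λ such that the generalized eigenspace
-- ker (M - λ I)^m  (m = size of M) is spanned by v.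
IsSimpleEigenvalue : {m : ℕ} → ℚ → Matrix m → Set
IsSimpleEigenvalue {m} λ' M =
  Σ (Vector m) λ v → ¬ IsZeroVec v × (∀ i → mulVec M v i ≡ λ' ℚ.* v i) ×
    (∀ (w : Vector m) → IsZeroVec (applyPow (shift M λ') m w) →
       Σ ℚ λ c → ∀ i → w i ≡ c ℚ.* v i)

lastIdx : (k : ℕ) → 1 ≤ k → Fin k
lastIdx (suc k) _ = fromℕ k

module Submission where

-- Number the 2k blocks from 0 and write n_j for their sizes, so that block j is a run of 1s iff j is
-- odd.  Off the diagonal Q_S has entries ±n_j, negative iff the later of the two blocks is a run of
-- 1s, and on the diagonal ±(n_i - 1).  With the prefix masses P_i = Σ_{j<i} n_j x_j, row i minus
-- row i + 1 of (Q_S + I) x is 2(P_{i+1} - x_{i+1}) for even i and 2(x_i - P_{i+1}) for odd i, and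
-- the last row is 2 x_{2k-1} - P_{2k}.  Hence (Q_S + I) x = 0 forces x_j = 0 for j < 2k - 2,
-- x_{2k-1} = s_k x_{2k-2} and (t_k - 1) x_{2k-1} = 0: the kernel is trivial when t_k > 1 and is
-- spanned by e_{2k-2} + s_k e_{2k-1} when t_k = 1.  In that case rows 2k - 2 and 2k - 1 of Q_S + I
-- add up to zero identically, while the eigenvector has 1 + s_k ≠ 0 there, so there is no Jordan
-- chain above it.

open import Defs
open import Data.Bool using (Bool; true; false; not; if_then_else_)
open import Data.Bool.Properties using (not-involutive)
open import Data.Fin as Fin using (Fin; toℕ; fromℕ<)
import Data.Fin.Properties as Finₚ
open import Data.Integer as ℤ using (ℤ)
import Data.Integer.Properties as ℤₚ
open import Data.List using (List; []; _∷_; _++_; replicate; concat; map; tabulate; allFin)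
open import Data.List.Properties using (map-tabulate; ++-assoc)
open import Data.Nat as ℕ using (ℕ; zero; suc; _∸_; _≤_; _<_; z≤n; s≤s)
import Data.Nat.Properties as ℕₚ
open import Data.Product using (Σ; _×_; _,_; proj₁; proj₂)
open import Data.Rational as ℚ using (ℚ; 0ℚ; 1ℚ)
import Data.Rational.Properties as ℚₚ
import Data.Rational.Unnormalised as ℚᵘ
import Data.Rational.Unnormalised.Properties as ℚᵘₚ
open import Data.Rational.Solver using (module +-*-Solver)
open import Data.Sum using (_⊎_; inj₁; inj₂)
open import Function using (_∘_)
open import Relation.Binary using (Tri; tri<; tri≈; tri>)
open import Relation.Nullary using (¬_; contradiction; does; yes; no)
open import Relation.Nullary.Decidable using (dec-true; dec-false)
open import Relation.Binary.PropositionalEquality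
open import Algebra.Properties.Group ℚₚ.+-0-group
  using (x∙y⁻¹≈ε⇒x≈y; inverseˡ-unique; identityʳ-unique; ∙-cancelˡ)

open +-*-Solver using (solve; _:=_; _:+_; _:*_; :-_; _:-_; con)

-- The threshold string and its blocks

module ThresholdString where
  open import Data.Nat using (_+_; _*_)
  open import Data.Integer using (+_)

  odd : ℕ → Bool
  odd zero    = false
  odd (suc n) = not (odd n)

  odd-2* : ∀ n → odd (2 * n) ≡ false
  odd-2* zero    = refl
  odd-2* (suc n) = trans (cong odd (ℕₚ.*-suc 2 n)) (trans (not-involutive _) (odd-2* n))

  odd-cases : ∀ i → odd i ≡ false ⊎ odd i ≡ true
  odd-cases i with odd i
  ... | false = inj₁ refl
  ... | true  = inj₂ refl

  odd-suc⇒even : ∀ {i} → odd (suc i) ≡ true → odd i ≡ false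
  odd-suc⇒even {i} odd[1+i] = trans (sym (not-involutive (odd i))) (cong not odd[1+i])

  even<even⇒suc< : ∀ {i a} → odd a ≡ false → odd i ≡ false → i < a → suc i < a
  even<even⇒suc< {i} even-a even-i i<a with ℕₚ.m≤n⇒m<n∨m≡n i<a
  ... | inj₁ 1+i<a = 1+i<a
  ... | inj₂ refl  = contradiction (trans (sym (cong not even-i)) even-a) λ ()

  runs : Bool → List ℕ → List Bool
  runs b []       = []
  runs b (n ∷ ns) = replicate n b ++ runs (not b) ns

  at-replicate-< : ∀ {A : Set} (d b : A) n ys {r} → r < n → at d (replicate n b ++ ys) r ≡ b
  at-replicate-< d b (suc n) ys {zero}  _         = refl
  at-replicate-< d b (suc n) ys {suc r} (s≤s r<n) = at-replicate-< d b n ys r<n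

  at-replicate-+ : ∀ {A : Set} (d b : A) n ys r → at d (replicate n b ++ ys) (n + r) ≡ at d ys r
  at-replicate-+ d b zero    ys r = refl
  at-replicate-+ d b (suc n) ys r = at-replicate-+ d b n ys r

  at-runs : ∀ i L j {r} → r < at 0 L j → at false (runs (odd i) L) (sumFirst j L + r) ≡ odd (i + j)
  at-runs i []      j       ()
  at-runs i (n ∷ L) zero    r<n =
    trans (at-replicate-< false (odd i) n _ r<n) (cong odd (sym (ℕₚ.+-identityʳ i)))
  at-runs i (n ∷ L) (suc j) {r} r<m = begin
    at false bs (n + sumFirst j L + r)                  ≡⟨ cong (at false bs) (ℕₚ.+-assoc n (sumFirst j L) r) ⟩
    at false bs (n + (sumFirst j L + r))                ≡⟨ at-replicate-+ false (odd i) n _ _ ⟩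
    at false (runs (odd (suc i)) L) (sumFirst j L + r)  ≡⟨ at-runs (suc i) L j r<m ⟩
    odd (suc i + j)                                     ≡⟨ cong odd (sym (ℕₚ.+-suc i j)) ⟩
    odd (i + suc j)                                     ∎
    where
    open ≡-Reasoning
    bs = runs (odd i) (n ∷ L)

  sumFirst+at≤sumFirst : ∀ L {i j} → i < j → sumFirst i L + at 0 L i ≤ sumFirst j L
  sumFirst+at≤sumFirst []      {zero}          _         = z≤n
  sumFirst+at≤sumFirst []      {suc i}         _         = z≤n
  sumFirst+at≤sumFirst (n ∷ L) {zero}  {suc j} _         = ℕₚ.m≤m+n n _
  sumFirst+at≤sumFirst (n ∷ L) {suc i} {suc j} (s≤s i<j) =
    ℕₚ.≤-trans (ℕₚ.≤-reflexive (ℕₚ.+-assoc n (sumFirst i L) (at 0 L i)))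
               (ℕₚ.+-monoʳ-≤ n (sumFirst+at≤sumFirst L i<j))

  map-allFin-suc : ∀ {A : Set} {k} (g : Fin (suc k) → A) →
                   map g (tabulate Fin.suc) ≡ map (g ∘ Fin.suc) (allFin k)
  map-allFin-suc g = trans (map-tabulate Fin.suc g) (sym (map-tabulate (λ i → i) (g ∘ Fin.suc)))

  module _ {k : ℕ} (s t : Fin (suc k) → ℕ) where

    private
      s′ t′ : Fin k → ℕ
      s′ = s ∘ Fin.suc
      t′ = t ∘ Fin.suc

    blockSizes-suc : blockSizes (suc k) s t ≡ s Fin.zero ∷ t Fin.zero ∷ blockSizes k s′ t′
    blockSizes-suc = cong (λ bs → s Fin.zero ∷ t Fin.zero ∷ concat bs)
                          (map-allFin-suc (λ j → s j ∷ t j ∷ []))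

    binString-suc : binString (suc k) s t ≡
                    replicate (s Fin.zero) false ++ replicate (t Fin.zero) true ++ binString k s′ t′
    binString-suc = trans (++-assoc (replicate (s Fin.zero) false) _ _)
      (cong (λ bs → replicate (s Fin.zero) false ++ replicate (t Fin.zero) true ++ concat bs)
            (map-allFin-suc (λ j → replicate (s j) false ++ replicate (t j) true)))

    blockSize-2+ : ∀ j → blockSize (suc k) s t (2 + j) ≡ blockSize k s′ t′ j
    blockSize-2+ j = cong (λ bs → at 0 bs (2 + j)) blockSizes-suc

  binString≡runs : ∀ k (s t : Fin k → ℕ) → binString k s t ≡ runs false (blockSizes k s t)
  binString≡runs zero    s t = refl
  binString≡runs (suc k) s t = begin
    binString (suc k) s t
      ≡⟨ binString-suc s t ⟩
    replicate (s Fin.zero) false ++ replicate (t Fin.zero) true ++ binString k s′ t′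
      ≡⟨ cong (λ bs → replicate (s Fin.zero) false ++ replicate (t Fin.zero) true ++ bs)
              (binString≡runs k s′ t′) ⟩
    runs false (s Fin.zero ∷ t Fin.zero ∷ blockSizes k s′ t′)
      ≡⟨ cong (runs false) (sym (blockSizes-suc s t)) ⟩
    runs false (blockSizes (suc k) s t) ∎
    where
    open ≡-Reasoning
    s′ = s ∘ Fin.suc
    t′ = t ∘ Fin.suc

  blockSize-pos : ∀ k (s t : Fin k → ℕ) → (∀ j → 1 ≤ s j) → (∀ j → 1 ≤ t j) →
                  ∀ j → j < 2 * k → 1 ≤ blockSize k s t j
  blockSize-pos (suc k) s t hs ht zero          _    = hs Fin.zero
  blockSize-pos (suc k) s t hs ht (suc zero)    _    = ht Fin.zero
  blockSize-pos (suc k) s t hs ht (suc (suc j)) j<2k =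
    subst (1 ≤_) (sym (blockSize-2+ s t j))
      (blockSize-pos k _ _ (hs ∘ Fin.suc) (ht ∘ Fin.suc) j
        (ℕₚ.≤-pred (ℕₚ.≤-pred (subst (suc (suc j) <_) (ℕₚ.*-suc 2 k) j<2k))))

  blockSize-last : ∀ k (s t : Fin (suc k) → ℕ) → blockSize (suc k) s t (suc (2 * k)) ≡ t (Fin.fromℕ k)
  blockSize-last zero    s t = refl
  blockSize-last (suc k) s t = begin
    blockSize (suc (suc k)) s t (suc (2 * suc k))  ≡⟨ cong (blockSize (suc (suc k)) s t ∘ suc) (ℕₚ.*-suc 2 k) ⟩
    blockSize (suc (suc k)) s t (2 + suc (2 * k))  ≡⟨ blockSize-2+ s t (suc (2 * k)) ⟩
    blockSize (suc k) _ _ (suc (2 * k))            ≡⟨ blockSize-last k _ _ ⟩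
    t (Fin.fromℕ (suc k))                          ∎
    where open ≡-Reasoning

  sign : Bool → ℤ
  sign b = if b then ℤ.-1ℤ else ℤ.1ℤ

  negateIfℤ : Bool → ℤ → ℤ
  negateIfℤ false z = z
  negateIfℤ true  z = ℤ.- z

  rangeSum-const : ∀ f a n b → (∀ {r} → r < n → f (a + r) ≡ sign b) → rangeSum f a n ≡ negateIfℤ b (+ n)
  rangeSum-const f a zero    false _  = refl
  rangeSum-const f a zero    true  _  = refl
  rangeSum-const f a (suc n) b     f≡ = begin
    f a ℤ.+ rangeSum f (suc a) n  ≡⟨ cong₂ ℤ._+_ (trans (cong f (sym (ℕₚ.+-identityʳ a))) (f≡ (s≤s z≤n)))
                                                 (rangeSum-const f (suc a) n b f′≡) ⟩
    sign b ℤ.+ negateIfℤ b (+ n)  ≡⟨ sign-+ b n ⟩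
    negateIfℤ b (+ suc n)         ∎
    where
    open ≡-Reasoning
    f′≡ : ∀ {r} → r < n → f (suc a + r) ≡ sign b
    f′≡ {r} r<n = trans (cong f (sym (ℕₚ.+-suc a r))) (f≡ (s≤s r<n))
    sign-+ : ∀ b n → sign b ℤ.+ negateIfℤ b (+ n) ≡ negateIfℤ b (+ suc n)
    sign-+ false n       = refl
    sign-+ true  zero    = refl
    sign-+ true  (suc n) = refl

  module _ (k : ℕ) (s t : Fin k → ℕ) where

    α-blockStart : ∀ j {r} → r < blockSize k s t j → α k s t (blockStart k s t j + r) ≡ odd j
    α-blockStart j {r} r<n =
      trans (cong (λ bs → at false bs (blockStart k s t j + r)) (binString≡runs k s t))
            (at-runs 0 (blockSizes k s t) j r<n)

    seidel-< : ∀ {v w} → v < w → seidel k s t v w ≡ sign (α k s t w)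
    seidel-< {v} {w} v<w rewrite dec-false (v ℕ.≟ w) (ℕₚ.<⇒≢ v<w) | dec-true (v ℕₚ.<? w) v<w = refl

    seidel-> : ∀ {v w} → w < v → seidel k s t v w ≡ sign (α k s t v)
    seidel-> {v} {w} w<v rewrite dec-false (v ℕ.≟ w) (ℕₚ.>⇒≢ w<v) | dec-false (v ℕₚ.<? w) (ℕₚ.<⇒≯ w<v)
                               | dec-true (w ℕₚ.<? v) w<v = refl

    seidel-diag : ∀ v → seidel k s t v v ≡ ℤ.0ℤ
    seidel-diag v rewrite dec-true (v ℕ.≟ v) refl = refl

    private
      start size : ℕ → ℕ
      start = blockStart k s t
      size  = blockSize k s t

    blockRowSum : ℕ → ℕ → ℤ
    blockRowSum i j = rangeSum (seidel k s t (start i)) (start j) (size j)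

    module _ (pos : ∀ j → j < 2 * k → 1 ≤ size j) where

      blockRowSum-< : ∀ {i j} → i < j → j < 2 * k → blockRowSum i j ≡ negateIfℤ (odd j) (+ size j)
      blockRowSum-< {i} {j} i<j j<2k = rangeSum-const _ _ _ _ λ {r} r<n →
        trans (seidel-< (start<start+r r)) (cong sign (α-blockStart j r<n))
        where
        start<start+r : ∀ r → start i < start j + r
        start<start+r r = ℕₚ.<-≤-trans (ℕₚ.m<m+n (start i) (pos i (ℕₚ.<-trans i<j j<2k)))
          (ℕₚ.≤-trans (sumFirst+at≤sumFirst (blockSizes k s t) i<j) (ℕₚ.m≤m+n (start j) r))

      blockRowSum-> : ∀ {i j} → j < i → i < 2 * k → blockRowSum i j ≡ negateIfℤ (odd i) (+ size j)
      blockRowSum-> {i} {j} j<i i<2k = rangeSum-const _ _ _ _ λ r<n →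
        trans (seidel-> (ℕₚ.<-≤-trans (ℕₚ.+-monoʳ-< (start j) r<n)
                                      (sumFirst+at≤sumFirst (blockSizes k s t) j<i)))
              (cong sign α-start)
        where
        α-start : α k s t (start i) ≡ odd i
        α-start = trans (cong (α k s t) (sym (ℕₚ.+-identityʳ (start i)))) (α-blockStart i (pos i i<2k))

    blockRowSum-diag : ∀ {i n} → size i ≡ suc n → blockRowSum i i ≡ negateIfℤ (odd i) (+ n)
    blockRowSum-diag {i} {n} size≡ = begin
      rangeSum f (start i) (size i)                 ≡⟨ cong (rangeSum f (start i)) size≡ ⟩
      f (start i) ℤ.+ rangeSum f (suc (start i)) n  ≡⟨ cong (ℤ._+ rangeSum f (suc (start i)) n)
                                                            (seidel-diag (start i)) ⟩
      ℤ.0ℤ ℤ.+ rangeSum f (suc (start i)) n         ≡⟨ ℤₚ.+-identityˡ _ ⟩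
      rangeSum f (suc (start i)) n                  ≡⟨ rangeSum-const f _ n _ f≡ ⟩
      negateIfℤ (odd i) (+ n)                       ∎
      where
      open ≡-Reasoning
      f = seidel k s t (start i)
      f≡ : ∀ {r} → r < n → f (suc (start i) + r) ≡ sign (odd i)
      f≡ {r} r<n = trans (seidel-< (s≤s (ℕₚ.m≤m+n (start i) r)))
        (cong sign (trans (cong (α k s t) (sym (ℕₚ.+-suc (start i) r)))
                          (α-blockStart i (subst (suc r <_) (sym size≡) (s≤s r<n)))))

open ThresholdString
open import Data.Rational using (_+_; _*_; -_; _-_)

-- Rationals and range sums

fromℤ : ℤ → ℚ
fromℤ z = z ℚ./ 1

fromℕ : ℕ → ℚ
fromℕ n = fromℤ (ℤ.+ n)

fromℤ-+ : ∀ p q → fromℤ (p ℤ.+ q) ≡ fromℤ p + fromℤ q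
fromℤ-+ p q = ℚₚ.toℚᵘ-injective (begin
  ℚ.toℚᵘ (fromℤ (p ℤ.+ q))
    ≈⟨ toℚᵘ-fromℤ (p ℤ.+ q) ⟩
  ℚᵘ.mkℚᵘ (p ℤ.+ q) 0
    ≈⟨ ℚᵘ.*≡* (cong₂ ℤ._*_ (cong₂ ℤ._+_ (sym (ℤₚ.*-identityʳ p)) (sym (ℤₚ.*-identityʳ q))) refl) ⟩
  ℚᵘ.mkℚᵘ p 0 ℚᵘ.+ ℚᵘ.mkℚᵘ q 0
    ≈⟨ ℚᵘₚ.+-cong (ℚᵘₚ.≃-sym (toℚᵘ-fromℤ p)) (ℚᵘₚ.≃-sym (toℚᵘ-fromℤ q)) ⟩
  ℚ.toℚᵘ (fromℤ p) ℚᵘ.+ ℚ.toℚᵘ (fromℤ q)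
    ≈⟨ ℚᵘₚ.≃-sym (ℚₚ.toℚᵘ-homo-+ (fromℤ p) (fromℤ q)) ⟩
  ℚ.toℚᵘ (fromℤ p + fromℤ q) ∎)
  where
  open ℚᵘₚ.≃-Reasoning
  toℚᵘ-fromℤ : ∀ z → ℚ.toℚᵘ (fromℤ z) ℚᵘ.≃ ℚᵘ.mkℚᵘ z 0
  toℚᵘ-fromℤ z = ℚₚ.toℚᵘ-fromℚᵘ (ℚᵘ.mkℚᵘ z 0)

fromℕ-suc : ∀ n → fromℕ (suc n) ≡ 1ℚ + fromℕ n
fromℕ-suc n = fromℤ-+ (ℤ.+ 1) (ℤ.+ n)

fromℕ-suc*x≡0⇒x≡0 : ∀ n {x} → fromℕ (suc n) * x ≡ 0ℚ → x ≡ 0ℚ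
fromℕ-suc*x≡0⇒x≡0 n {x} qx≡0 = begin
  x                 ≡⟨ sym (ℚₚ.*-identityˡ x) ⟩
  1ℚ * x            ≡⟨ cong (_* x) (sym (ℚₚ.*-inverseˡ q)) ⟩
  (ℚ.1/ q * q) * x  ≡⟨ ℚₚ.*-assoc (ℚ.1/ q) q x ⟩
  ℚ.1/ q * (q * x)  ≡⟨ cong (ℚ.1/ q *_) qx≡0 ⟩
  ℚ.1/ q * 0ℚ       ≡⟨ ℚₚ.*-zeroʳ (ℚ.1/ q) ⟩
  0ℚ                ∎
  where
  open ≡-Reasoning
  q = fromℕ (suc n)
  instance
    q-pos : ℚ.Positive q
    q-pos = ℚₚ.normalize-pos (suc n) 1
    q-nonZero : ℚ.NonZero q
    q-nonZero = ℚₚ.pos⇒nonZero q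

p+p-[q+q]≡0⇒p≡q : ∀ p q → (p + p) - (q + q) ≡ 0ℚ → p ≡ q
p+p-[q+q]≡0⇒p≡q p q 2p-2q≡0 = x∙y⁻¹≈ε⇒x≈y p q (fromℕ-suc*x≡0⇒x≡0 1 (begin
  fromℕ 2 * (p - q)  ≡⟨ solve 2 (λ p q → con (fromℕ 2) :* (p :- q) := (p :+ p) :- (q :+ q)) refl p q ⟩
  (p + p) - (q + q)  ≡⟨ 2p-2q≡0 ⟩
  0ℚ                 ∎))
  where open ≡-Reasoning

r+[p+p-[q+q]]≡r : ∀ r {p q} → p ≡ q → r + ((p + p) - (q + q)) ≡ r
r+[p+p-[q+q]]≡r r {p} refl = trans (cong (r +_) (ℚₚ.+-inverseʳ (p + p))) (ℚₚ.+-identityʳ r)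

negateIf : Bool → ℚ → ℚ
negateIf false p = p
negateIf true  p = - p

fromℤ-negateIfℤ : ∀ b n → fromℤ (negateIfℤ b (ℤ.+ n)) ≡ negateIf b (fromℕ n)
fromℤ-negateIfℤ false n       = refl
fromℤ-negateIfℤ true  zero    = refl
fromℤ-negateIfℤ true  (suc n) = refl

negateIf-*ˡ : ∀ b p q → negateIf b p * q ≡ negateIf b (p * q)
negateIf-*ˡ false p q = refl
negateIf-*ˡ true  p q = sym (ℚₚ.neg-distribˡ-* p q)

sumRange : (ℕ → ℚ) → ℕ → ℕ → ℚ
sumRange f a zero    = 0ℚ
sumRange f a (suc l) = f a + sumRange f (suc a) l

sumRange-cong : ∀ {f g} a l → (∀ {j} → a ≤ j → j < a ℕ.+ l → f j ≡ g j) → sumRange f a l ≡ sumRange g a l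
sumRange-cong a zero    f≡g = refl
sumRange-cong a (suc l) f≡g = cong₂ _+_ (f≡g ℕₚ.≤-refl (ℕₚ.m<m+n a (s≤s z≤n)))
  (sumRange-cong (suc a) l λ {j} a<j j<a+1+l →
    f≡g (ℕₚ.<⇒≤ a<j) (subst (j <_) (sym (ℕₚ.+-suc a l)) j<a+1+l))

sumRange-zero : ∀ {f} a l → (∀ {j} → a ≤ j → j < a ℕ.+ l → f j ≡ 0ℚ) → sumRange f a l ≡ 0ℚ
sumRange-zero a l f≡0 = trans (sumRange-cong a l f≡0) (sumRange-0 a l)
  where
  sumRange-0 : ∀ a l → sumRange (λ _ → 0ℚ) a l ≡ 0ℚ
  sumRange-0 a zero    = refl
  sumRange-0 a (suc l) = trans (ℚₚ.+-identityˡ _) (sumRange-0 (suc a) l)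

sumRange-+ : ∀ f a l₁ l₂ → sumRange f a (l₁ ℕ.+ l₂) ≡ sumRange f a l₁ + sumRange f (a ℕ.+ l₁) l₂
sumRange-+ f a zero     l₂ = begin
  sumRange f a l₂               ≡⟨ cong (λ a′ → sumRange f a′ l₂) (sym (ℕₚ.+-identityʳ a)) ⟩
  sumRange f (a ℕ.+ 0) l₂       ≡⟨ sym (ℚₚ.+-identityˡ _) ⟩
  0ℚ + sumRange f (a ℕ.+ 0) l₂  ∎
  where open ≡-Reasoning
sumRange-+ f a (suc l₁) l₂ = begin
  f a + sumRange f (suc a) (l₁ ℕ.+ l₂)
    ≡⟨ cong (f a +_) (sumRange-+ f (suc a) l₁ l₂) ⟩
  f a + (sumRange f (suc a) l₁ + sumRange f (suc a ℕ.+ l₁) l₂)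
    ≡⟨ sym (ℚₚ.+-assoc (f a) _ _) ⟩
  f a + sumRange f (suc a) l₁ + sumRange f (suc a ℕ.+ l₁) l₂
    ≡⟨ cong (λ a′ → f a + sumRange f (suc a) l₁ + sumRange f a′ l₂) (sym (ℕₚ.+-suc a l₁)) ⟩
  f a + sumRange f (suc a) l₁ + sumRange f (a ℕ.+ suc l₁) l₂ ∎
  where open ≡-Reasoning

sumRange-suc : ∀ f a l → sumRange f a (suc l) ≡ sumRange f a l + f (a ℕ.+ l)
sumRange-suc f a l = begin
  sumRange f a (suc l)                 ≡⟨ cong (sumRange f a) (ℕₚ.+-comm 1 l) ⟩
  sumRange f a (l ℕ.+ 1)               ≡⟨ sumRange-+ f a l 1 ⟩
  sumRange f a l + (f (a ℕ.+ l) + 0ℚ)  ≡⟨ cong (sumRange f a l +_) (ℚₚ.+-identityʳ _) ⟩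
  sumRange f a l + f (a ℕ.+ l)         ∎
  where open ≡-Reasoning

sumRange-negateIf : ∀ b f a l → sumRange (λ j → negateIf b (f j)) a l ≡ negateIf b (sumRange f a l)
sumRange-negateIf false f a l       = refl
sumRange-negateIf true  f a zero    = refl
sumRange-negateIf true  f a (suc l) =
  trans (cong (- f a +_) (sumRange-negateIf true f (suc a) l)) (sym (ℚₚ.neg-distrib-+ (f a) _))

locally-constant⇒≡-top : ∀ {A : Set} (f : ℕ → A) top → (∀ {i} → i < top → f i ≡ f (suc i)) →
                         ∀ {i} → i ≤ top → f i ≡ f top
locally-constant⇒≡-top f zero      step z≤n = refl
locally-constant⇒≡-top f (suc top) step i≤1+top with ℕₚ.m≤n⇒m<n∨m≡n i≤1+top
... | inj₂ refl  = refl
... | inj₁ i<1+top =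
  trans (locally-constant⇒≡-top f top (λ i<top → step (ℕₚ.m<n⇒m<1+n i<top)) (ℕₚ.≤-pred i<1+top))
        (step ℕₚ.≤-refl)

-- The quotient matrix in closed form

-- Q_S when block j has 1 + nv j vertices.
quotientForm : (ℕ → ℕ) → ℕ → ℕ → ℚ
quotientForm nv i j with ℕₚ.<-cmp i j
... | tri< _ _ _ = negateIf (odd j) (fromℕ (suc (nv j)))
... | tri≈ _ _ _ = negateIf (odd i) (fromℕ (nv i))
... | tri> _ _ _ = negateIf (odd i) (fromℕ (suc (nv j)))

module _ (nv : ℕ → ℕ) where

  quotientForm-< : ∀ {i j} → i < j → quotientForm nv i j ≡ negateIf (odd j) (fromℕ (suc (nv j)))
  quotientForm-< {i} {j} i<j with ℕₚ.<-cmp i j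
  ... | tri< _    _ _ = refl
  ... | tri≈ i≮j _ _ = contradiction i<j i≮j
  ... | tri> i≮j _ _ = contradiction i<j i≮j

  quotientForm-> : ∀ {i j} → j < i → quotientForm nv i j ≡ negateIf (odd i) (fromℕ (suc (nv j)))
  quotientForm-> {i} {j} j<i with ℕₚ.<-cmp i j
  ... | tri< _ _ j≮i = contradiction j<i j≮i
  ... | tri≈ _ _ j≮i = contradiction j<i j≮i
  ... | tri> _ _ _    = refl

  quotientForm-diag : ∀ i → quotientForm nv i i ≡ negateIf (odd i) (fromℕ (nv i))
  quotientForm-diag i with ℕₚ.<-cmp i i
  ... | tri< _ i≢i _ = contradiction refl i≢i
  ... | tri≈ _ _ _   = refl
  ... | tri> _ i≢i _ = contradiction refl i≢i

-- row x i is the i-th entry of (Q_S + I) x for 2 + a blocks; the last pair of blocks is a, suc a.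
module QuotientRows (a : ℕ) (a-even : odd a ≡ false) (nv : ℕ → ℕ) where

  m : ℕ
  m = suc (suc a)

  size : ℕ → ℚ
  size j = fromℕ (suc (nv j))

  mass : (ℕ → ℚ) → ℕ → ℚ
  mass x j = size j * x j

  prefix : (ℕ → ℚ) → ℕ → ℚ
  prefix x i = sumRange (mass x) 0 i

  tail : (ℕ → ℚ) → ℕ → ℚ
  tail x i = sumRange (λ j → negateIf (odd j) (mass x j)) i (m ∸ i)

  row : (ℕ → ℚ) → ℕ → ℚ
  row x i = sumRange (λ j → quotientForm nv i j * x j) 0 m + x i

  module _ (x : ℕ → ℚ) where
    open ≡-Reasoning

    prefix-suc : ∀ i → prefix x (suc i) ≡ prefix x i + mass x i
    prefix-suc = sumRange-suc (mass x) 0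

    mass≡ : ∀ j → mass x j ≡ (1ℚ + fromℕ (nv j)) * x j
    mass≡ j = cong (_* x j) (fromℕ-suc (nv j))

    prefix-suc′ : ∀ i → prefix x (suc i) ≡ prefix x i + (1ℚ + fromℕ (nv i)) * x i
    prefix-suc′ i = trans (prefix-suc i) (cong (prefix x i +_) (mass≡ i))

    tail-suc : ∀ {i} → i < m → tail x i ≡ negateIf (odd i) (mass x i) + tail x (suc i)
    tail-suc {i} i<m = cong (sumRange (λ j → negateIf (odd j) (mass x j)) i) (ℕₚ.+-∸-assoc 1 i<m)

    tail-end : tail x m ≡ 0ℚ
    tail-end = cong (sumRange (λ j → negateIf (odd j) (mass x j)) m) (ℕₚ.n∸n≡0 m)

    row-split : ∀ {i} → i < m →
      row x i ≡ negateIf (odd i) (prefix x i) + negateIf (odd i) (fromℕ (nv i) * x i) + tail x (suc i) + x i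
    row-split {i} i<m = cong (_+ x i) (begin
      sumRange g 0 m
        ≡⟨ cong (sumRange g 0) (sym (ℕₚ.m+[n∸m]≡n (ℕₚ.<⇒≤ i<m))) ⟩
      sumRange g 0 (i ℕ.+ (m ∸ i))
        ≡⟨ sumRange-+ g 0 i (m ∸ i) ⟩
      sumRange g 0 i + sumRange g i (m ∸ i)
        ≡⟨ cong (λ l → sumRange g 0 i + sumRange g i l) (ℕₚ.+-∸-assoc 1 i<m) ⟩
      sumRange g 0 i + (g i + sumRange g (suc i) (m ∸ suc i))
        ≡⟨ cong₂ (λ p q → p + (q + sumRange g (suc i) (m ∸ suc i))) before diagonal ⟩
      negateIf (odd i) (prefix x i) + (negateIf (odd i) (fromℕ (nv i) * x i) + sumRange g (suc i) (m ∸ suc i))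
        ≡⟨ cong (λ p → negateIf (odd i) (prefix x i) + (negateIf (odd i) (fromℕ (nv i) * x i) + p)) after ⟩
      negateIf (odd i) (prefix x i) + (negateIf (odd i) (fromℕ (nv i) * x i) + tail x (suc i))
        ≡⟨ sym (ℚₚ.+-assoc (negateIf (odd i) (prefix x i)) (negateIf (odd i) (fromℕ (nv i) * x i))
                           (tail x (suc i))) ⟩
      negateIf (odd i) (prefix x i) + negateIf (odd i) (fromℕ (nv i) * x i) + tail x (suc i) ∎)
      where
      g : ℕ → ℚ
      g j = quotientForm nv i j * x j
      before : sumRange g 0 i ≡ negateIf (odd i) (prefix x i)
      before = trans (sumRange-cong 0 i λ {j} _ j<i →
                        trans (cong (_* x j) (quotientForm-> nv j<i)) (negateIf-*ˡ (odd i) (size j) (x j)))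
                     (sumRange-negateIf (odd i) (mass x) 0 i)
      diagonal : g i ≡ negateIf (odd i) (fromℕ (nv i) * x i)
      diagonal = trans (cong (_* x i) (quotientForm-diag nv i)) (negateIf-*ˡ (odd i) _ (x i))
      after : sumRange g (suc i) (m ∸ suc i) ≡ tail x (suc i)
      after = sumRange-cong (suc i) (m ∸ suc i) λ {j} i<j _ →
                trans (cong (_* x j) (quotientForm-< nv i<j)) (negateIf-*ˡ (odd j) (size j) (x j))

    row-even : ∀ {i} → odd i ≡ false → i < m → row x i ≡ prefix x (suc i) + tail x (suc i)
    row-even {i} oi i<m = begin
      row x i
        ≡⟨ row-split i<m ⟩
      negateIf (odd i) (prefix x i) + negateIf (odd i) (fromℕ (nv i) * x i) + tail x (suc i) + x i
        ≡⟨ cong (λ b → negateIf b (prefix x i) + negateIf b (fromℕ (nv i) * x i) + tail x (suc i) + x i) oi ⟩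
      prefix x i + fromℕ (nv i) * x i + tail x (suc i) + x i
        ≡⟨ solve 4 (λ p n t y → p :+ n :* y :+ t :+ y := p :+ (con 1ℚ :+ n) :* y :+ t) refl
                 (prefix x i) (fromℕ (nv i)) (tail x (suc i)) (x i) ⟩
      prefix x i + (1ℚ + fromℕ (nv i)) * x i + tail x (suc i)
        ≡⟨ cong (λ p → p + tail x (suc i)) (sym (prefix-suc′ i)) ⟩
      prefix x (suc i) + tail x (suc i) ∎

    row-odd : ∀ {i} → odd i ≡ true → i < m → row x i ≡ (x i + x i) - prefix x (suc i) + tail x (suc i)
    row-odd {i} oi i<m = begin
      row x i
        ≡⟨ row-split i<m ⟩
      negateIf (odd i) (prefix x i) + negateIf (odd i) (fromℕ (nv i) * x i) + tail x (suc i) + x i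
        ≡⟨ cong (λ b → negateIf b (prefix x i) + negateIf b (fromℕ (nv i) * x i) + tail x (suc i) + x i) oi ⟩
      - prefix x i + - (fromℕ (nv i) * x i) + tail x (suc i) + x i
        ≡⟨ solve 4 (λ p n t y → :- p :+ :- (n :* y) :+ t :+ y := (y :+ y) :- (p :+ (con 1ℚ :+ n) :* y) :+ t) refl
                 (prefix x i) (fromℕ (nv i)) (tail x (suc i)) (x i) ⟩
      (x i + x i) - (prefix x i + (1ℚ + fromℕ (nv i)) * x i) + tail x (suc i)
        ≡⟨ cong (λ p → (x i + x i) - p + tail x (suc i)) (sym (prefix-suc′ i)) ⟩
      (x i + x i) - prefix x (suc i) + tail x (suc i) ∎

    row-step-even : ∀ {i} → odd i ≡ false → suc i < m →
      row x i ≡ row x (suc i) + ((prefix x (suc i) + prefix x (suc i)) - (x (suc i) + x (suc i)))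
    row-step-even {i} oi si<m = begin
      row x i
        ≡⟨ row-even oi (ℕₚ.<-trans (ℕₚ.n<1+n i) si<m) ⟩
      p + tail x (suc i)
        ≡⟨ cong (p +_) (trans (tail-suc si<m) (cong (λ b → negateIf b w + t) (cong not oi))) ⟩
      p + (- w + t)
        ≡⟨ solve 4 (λ p w y t → p :+ (:- w :+ t) := (y :+ y) :- (p :+ w) :+ t :+ ((p :+ p) :- (y :+ y)))
                   refl p w y t ⟩
      (y + y) - (p + w) + t + ((p + p) - (y + y))
        ≡⟨ cong (λ q → (y + y) - q + t + ((p + p) - (y + y))) (sym (prefix-suc (suc i))) ⟩
      (y + y) - prefix x (suc (suc i)) + t + ((p + p) - (y + y))
        ≡⟨ cong (_+ ((p + p) - (y + y))) (sym (row-odd (cong not oi) si<m)) ⟩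
      row x (suc i) + ((p + p) - (y + y)) ∎
      where
      p = prefix x (suc i)
      w = mass x (suc i)
      y = x (suc i)
      t = tail x (suc (suc i))

    row-step-odd : ∀ {i} → odd i ≡ true → suc i < m →
      row x i ≡ row x (suc i) + ((x i + x i) - (prefix x (suc i) + prefix x (suc i)))
    row-step-odd {i} oi si<m = begin
      row x i
        ≡⟨ row-odd oi (ℕₚ.<-trans (ℕₚ.n<1+n i) si<m) ⟩
      (y + y) - p + tail x (suc i)
        ≡⟨ cong ((y + y) - p +_) (trans (tail-suc si<m) (cong (λ b → negateIf b w + t) (cong not oi))) ⟩
      (y + y) - p + (w + t)
        ≡⟨ solve 4 (λ p w y t → (y :+ y) :- p :+ (w :+ t) := p :+ w :+ t :+ ((y :+ y) :- (p :+ p))) refl p w y t ⟩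
      p + w + t + ((y + y) - (p + p))
        ≡⟨ cong (λ q → q + t + ((y + y) - (p + p))) (sym (prefix-suc (suc i))) ⟩
      prefix x (suc (suc i)) + t + ((y + y) - (p + p))
        ≡⟨ cong (_+ ((y + y) - (p + p))) (sym (row-even (cong not oi) si<m)) ⟩
      row x (suc i) + ((y + y) - (p + p)) ∎
      where
      p = prefix x (suc i)
      w = mass x (suc i)
      y = x i
      t = tail x (suc (suc i))

    row-last : row x (suc a) ≡ (x (suc a) + x (suc a)) - prefix x m
    row-last = begin
      row x (suc a)                                           ≡⟨ row-odd (cong not a-even) ℕₚ.≤-refl ⟩
      (x (suc a) + x (suc a)) - prefix x m + tail x m  ≡⟨ cong ((x (suc a) + x (suc a)) - prefix x m +_) tail-end ⟩
      (x (suc a) + x (suc a)) - prefix x m + 0ℚ               ≡⟨ ℚₚ.+-identityʳ _ ⟩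
      (x (suc a) + x (suc a)) - prefix x m                    ∎

  <m-cases : ∀ {j} → j < m → j < a ⊎ j ≡ a ⊎ j ≡ suc a
  <m-cases (s≤s j≤sa) with ℕₚ.m≤n⇒m<n∨m≡n j≤sa
  ... | inj₂ j≡sa          = inj₂ (inj₂ j≡sa)
  ... | inj₁ (s≤s j≤a) with ℕₚ.m≤n⇒m<n∨m≡n j≤a
  ...   | inj₁ j<a = inj₁ j<a
  ...   | inj₂ j≡a = inj₂ (inj₁ j≡a)

  <a⇒suc<m : ∀ {j} → j < a → suc j < m
  <a⇒suc<m j<a = s≤s (ℕₚ.m≤n⇒m≤1+n j<a)

  eigvec : ℕ → ℚ
  eigvec j = if does (j ℕ.≟ a) then 1ℚ else if does (j ℕ.≟ suc a) then size a else 0ℚ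

  eigvec-a : eigvec a ≡ 1ℚ
  eigvec-a rewrite dec-true (a ℕ.≟ a) refl = refl

  eigvec-b : eigvec (suc a) ≡ size a
  eigvec-b rewrite dec-false (suc a ℕ.≟ a) (ℕₚ.>⇒≢ (ℕₚ.n<1+n a)) | dec-true (suc a ℕ.≟ suc a) refl = refl

  eigvec-below : ∀ {j} → j < a → eigvec j ≡ 0ℚ
  eigvec-below {j} j<a rewrite dec-false (j ℕ.≟ a) (ℕₚ.<⇒≢ j<a)
                             | dec-false (j ℕ.≟ suc a) (ℕₚ.<⇒≢ (ℕₚ.m<n⇒m<1+n j<a)) = refl

  module Kernel (x : ℕ → ℚ) (row≡0 : ∀ {i} → i < m → row x i ≡ 0ℚ) where
    open ≡-Reasoning

    private
      defect≡0 : ∀ {i d} → suc i < m → row x i ≡ row x (suc i) + d → d ≡ 0ℚ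
      defect≡0 {i} {d} si<m step = begin
        d                   ≡⟨ sym (ℚₚ.+-identityˡ d) ⟩
        0ℚ + d              ≡⟨ cong (_+ d) (sym (row≡0 si<m)) ⟩
        row x (suc i) + d   ≡⟨ sym step ⟩
        row x i             ≡⟨ row≡0 (ℕₚ.<-trans (ℕₚ.n<1+n i) si<m) ⟩
        0ℚ                  ∎

    prefix-even : ∀ {i} → odd i ≡ false → suc i < m → prefix x (suc i) ≡ x (suc i)
    prefix-even oi si<m = p+p-[q+q]≡0⇒p≡q _ _ (defect≡0 si<m (row-step-even x oi si<m))

    prefix-odd : ∀ {i} → odd i ≡ true → suc i < m → prefix x (suc i) ≡ x i
    prefix-odd oi si<m = sym (p+p-[q+q]≡0⇒p≡q _ _ (defect≡0 si<m (row-step-odd x oi si<m)))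

    x-odd≡0 : ∀ {j} → odd j ≡ true → j < a → x j ≡ 0ℚ
    x-odd≡0 {zero}  ()
    x-odd≡0 {suc i} oj j<a = fromℕ-suc*x≡0⇒x≡0 (nv (suc i)) (identityʳ-unique (x (suc i)) (mass x (suc i)) (begin
      x (suc i) + mass x (suc i)          ≡⟨ cong (_+ mass x (suc i)) (sym (prefix-even (odd-suc⇒even {i} oj) 1+i<m)) ⟩
      prefix x (suc i) + mass x (suc i)   ≡⟨ sym (prefix-suc x (suc i)) ⟩
      prefix x (suc (suc i))              ≡⟨ prefix-odd oj (<a⇒suc<m j<a) ⟩
      x (suc i)                           ∎))
      where
      1+i<m : suc i < m
      1+i<m = ℕₚ.m<n⇒m<1+n (ℕₚ.m<n⇒m<1+n j<a)

    prefix≡0 : ∀ {j} → j ≤ a → prefix x j ≡ 0ℚ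
    prefix≡0 {zero}  _   = refl
    prefix≡0 {suc i} i<a with odd-cases i
    ... | inj₂ oi = trans (prefix-odd oi (<a⇒suc<m i<a)) (x-odd≡0 oi i<a)
    ... | inj₁ oi = trans (prefix-even oi (<a⇒suc<m i<a))
                          (x-odd≡0 {suc i} (cong not oi) (even<even⇒suc< a-even oi i<a))

    x-below≡0 : ∀ {j} → j < a → x j ≡ 0ℚ
    x-below≡0 {j} j<a = fromℕ-suc*x≡0⇒x≡0 (nv j) (begin
      mass x j                 ≡⟨ sym (ℚₚ.+-identityˡ _) ⟩
      0ℚ + mass x j            ≡⟨ cong (_+ mass x j) (sym (prefix≡0 (ℕₚ.<⇒≤ j<a))) ⟩
      prefix x j + mass x j    ≡⟨ sym (prefix-suc x j) ⟩
      prefix x (suc j)         ≡⟨ prefix≡0 j<a ⟩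
      0ℚ                       ∎)

    x-last≡mass : x (suc a) ≡ mass x a
    x-last≡mass = begin
      x (suc a)                ≡⟨ sym (prefix-even a-even ℕₚ.≤-refl) ⟩
      prefix x (suc a)         ≡⟨ prefix-suc x a ⟩
      prefix x a + mass x a    ≡⟨ cong (_+ mass x a) (prefix≡0 ℕₚ.≤-refl) ⟩
      0ℚ + mass x a            ≡⟨ ℚₚ.+-identityˡ _ ⟩
      mass x a                 ∎

    nv-last*x-last≡0 : fromℕ (nv (suc a)) * x (suc a) ≡ 0ℚ
    nv-last*x-last≡0 = identityʳ-unique y (fromℕ (nv (suc a)) * y) (begin
      y + fromℕ (nv (suc a)) * y       ≡⟨ solve 2 (λ n y → y :+ n :* y := (con 1ℚ :+ n) :* y)
                                                  refl (fromℕ (nv (suc a))) y ⟩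
      (1ℚ + fromℕ (nv (suc a))) * y    ≡⟨ sym (mass≡ x (suc a)) ⟩
      mass x (suc a)                   ≡⟨ ∙-cancelˡ y _ _ (begin
        y + mass x (suc a)                 ≡⟨ cong (_+ mass x (suc a)) (sym (prefix-even a-even ℕₚ.≤-refl)) ⟩
        prefix x (suc a) + mass x (suc a)  ≡⟨ sym (prefix-suc x (suc a)) ⟩
        prefix x m                         ≡⟨ prefix-end ⟩
        y + y                              ∎) ⟩
      y                                ∎)
      where
      y = x (suc a)
      prefix-end : prefix x m ≡ y + y
      prefix-end = sym (x∙y⁻¹≈ε⇒x≈y (y + y) (prefix x m) (trans (sym (row-last x)) (row≡0 ℕₚ.≤-refl)))

    kernel-spanned : ∀ {j} → j < m → x j ≡ x a * eigvec j
    kernel-spanned j<m with <m-cases j<m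
    ... | inj₁ j<a         =
      trans (x-below≡0 j<a) (sym (trans (cong (x a *_) (eigvec-below j<a)) (ℚₚ.*-zeroʳ (x a))))
    ... | inj₂ (inj₁ refl) = sym (trans (cong (x a *_) eigvec-a) (ℚₚ.*-identityʳ (x a)))
    ... | inj₂ (inj₂ refl) = trans x-last≡mass (trans (ℚₚ.*-comm (size a) (x a)) (cong (x a *_) (sym eigvec-b)))

    kernel-trivial : ∀ {n} → nv (suc a) ≡ suc n → ∀ {j} → j < m → x j ≡ 0ℚ
    kernel-trivial {n} nv≡ {j} j<m = begin
      x j              ≡⟨ kernel-spanned j<m ⟩
      x a * eigvec j   ≡⟨ cong (_* eigvec j) (fromℕ-suc*x≡0⇒x≡0 (nv a) (trans (sym x-last≡mass) last-vanishes)) ⟩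
      0ℚ * eigvec j    ≡⟨ ℚₚ.*-zeroˡ (eigvec j) ⟩
      0ℚ               ∎
      where
      last-vanishes : x (suc a) ≡ 0ℚ
      last-vanishes =
        fromℕ-suc*x≡0⇒x≡0 n (trans (cong (λ k → fromℕ k * x (suc a)) (sym nv≡)) nv-last*x-last≡0)

  module _ (nv-last≡0 : nv (suc a) ≡ 0) where
    open ≡-Reasoning

    mass-last≡ : ∀ x → mass x (suc a) ≡ x (suc a)
    mass-last≡ x = trans (cong (λ n → fromℕ (suc n) * x (suc a)) nv-last≡0) (ℚₚ.*-identityˡ (x (suc a)))

    row-a+row-last≡0 : ∀ x → row x a + row x (suc a) ≡ 0ℚ
    row-a+row-last≡0 x = begin
      row x a + row x (suc a)
        ≡⟨ cong (_+ row x (suc a)) (row-step-even x a-even ℕₚ.≤-refl) ⟩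
      row x (suc a) + d + row x (suc a)
        ≡⟨ cong (λ r → r + d + r) (row-last x) ⟩
      (y + y) - prefix x m + d + ((y + y) - prefix x m)
        ≡⟨ cong (λ q → (y + y) - q + d + ((y + y) - q))
                (trans (prefix-suc x (suc a)) (cong (p +_) (mass-last≡ x))) ⟩
      (y + y) - (p + y) + d + ((y + y) - (p + y))
        ≡⟨ solve 2 (λ p y → (y :+ y) :- (p :+ y) :+ ((p :+ p) :- (y :+ y)) :+ ((y :+ y) :- (p :+ y)) := con 0ℚ)
                   refl p y ⟩
      0ℚ ∎
      where
      p = prefix x (suc a)
      y = x (suc a)
      d = (p + p) - (y + y)

    eigvec-row≡0 : ∀ {i} → i < m → row eigvec i ≡ 0ℚ
    eigvec-row≡0 i<m = trans (locally-constant⇒≡-top (row eigvec) (suc a) step (ℕₚ.≤-pred i<m)) last-row≡0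
      where
      prefix-below : ∀ {j} → j ≤ a → prefix eigvec j ≡ 0ℚ
      prefix-below {j} j≤a = sumRange-zero 0 j λ {l} _ l<j →
        trans (cong (size l *_) (eigvec-below (ℕₚ.<-≤-trans l<j j≤a))) (ℚₚ.*-zeroʳ (size l))

      prefix-a : prefix eigvec (suc a) ≡ size a
      prefix-a = begin
        prefix eigvec (suc a)                  ≡⟨ prefix-suc eigvec a ⟩
        prefix eigvec a + size a * eigvec a    ≡⟨ cong₂ (λ p e → p + size a * e) (prefix-below ℕₚ.≤-refl) eigvec-a ⟩
        0ℚ + size a * 1ℚ                       ≡⟨ solve 1 (λ s → con 0ℚ :+ s :* con 1ℚ := s) refl (size a) ⟩
        size a                                 ∎

      last-row≡0 : row eigvec (suc a) ≡ 0ℚ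
      last-row≡0 = begin
        row eigvec (suc a)
          ≡⟨ row-last eigvec ⟩
        (e + e) - prefix eigvec m
          ≡⟨ cong (λ q → (e + e) - q)
                  (trans (prefix-suc eigvec (suc a)) (cong₂ _+_ prefix-a (mass-last≡ eigvec))) ⟩
        (e + e) - (size a + e)
          ≡⟨ cong (λ e′ → (e′ + e′) - (size a + e′)) eigvec-b ⟩
        (size a + size a) - (size a + size a)
          ≡⟨ ℚₚ.+-inverseʳ (size a + size a) ⟩
        0ℚ ∎
        where e = eigvec (suc a)

      step : ∀ {i} → i < suc a → row eigvec i ≡ row eigvec (suc i)
      step {i} (s≤s i≤a) with odd-cases i | ℕₚ.m≤n⇒m<n∨m≡n i≤a
      ... | inj₁ oi | inj₁ i<a  = trans (row-step-even eigvec oi (s≤s (s≤s i≤a)))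
          (r+[p+p-[q+q]]≡r _ (trans (prefix-below i<a) (sym (eigvec-below (even<even⇒suc< a-even oi i<a)))))
      ... | inj₁ oi | inj₂ refl = trans (row-step-even eigvec oi ℕₚ.≤-refl)
          (r+[p+p-[q+q]]≡r _ (trans prefix-a (sym eigvec-b)))
      ... | inj₂ oi | inj₁ i<a  = trans (row-step-odd eigvec oi (s≤s (s≤s i≤a)))
          (r+[p+p-[q+q]]≡r _ (trans (eigvec-below i<a) (sym (prefix-below i<a))))
      ... | inj₂ oi | inj₂ refl = contradiction (trans (sym oi) a-even) λ ()

  row-cong : ∀ {x y} → (∀ {l} → l < m → x l ≡ y l) → ∀ {i} → i < m → row x i ≡ row y i
  row-cong {x} {y} x≡y {i} i<m =
    cong₂ _+_ (sumRange-cong 0 m λ {l} _ l<m → cong (quotientForm nv i l *_) (x≡y l<m)) (x≡y i<m)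

-- Vectors and matrices indexed by Fin

finSum-cong : ∀ {n} {f g : Fin n → ℚ} → (∀ i → f i ≡ g i) → finSum f ≡ finSum g
finSum-cong {zero}  f≡g = refl
finSum-cong {suc n} f≡g = cong₂ _+_ (f≡g Fin.zero) (finSum-cong (λ i → f≡g (Fin.suc i)))

finSum-+ : ∀ {n} (f g : Fin n → ℚ) → finSum (λ i → f i + g i) ≡ finSum f + finSum g
finSum-+ {zero}  f g = sym (ℚₚ.+-identityˡ 0ℚ)
finSum-+ {suc n} f g =
  trans (cong (f Fin.zero + g Fin.zero +_) (finSum-+ (λ i → f (Fin.suc i)) (λ i → g (Fin.suc i))))
        (solve 4 (λ a b c d → a :+ b :+ (c :+ d) := a :+ c :+ (b :+ d)) refl (f Fin.zero) (g Fin.zero) _ _)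

finSum-zero : ∀ n → finSum {n} (λ _ → 0ℚ) ≡ 0ℚ
finSum-zero zero    = refl
finSum-zero (suc n) = trans (ℚₚ.+-identityˡ _) (finSum-zero n)

finSum-identity : ∀ {n} (x : Vector n) i → finSum (λ j → identity i j * x j) ≡ x i
finSum-identity {suc n} x Fin.zero = begin
  1ℚ * x Fin.zero + finSum (λ j → 0ℚ * x (Fin.suc j))
    ≡⟨ cong₂ _+_ (ℚₚ.*-identityˡ (x Fin.zero))
                 (finSum-cong {n} {λ j → 0ℚ * x (Fin.suc j)} (λ j → ℚₚ.*-zeroˡ (x (Fin.suc j)))) ⟩
  x Fin.zero + finSum {n} (λ _ → 0ℚ)                    ≡⟨ cong (x Fin.zero +_) (finSum-zero n) ⟩
  x Fin.zero + 0ℚ                                       ≡⟨ ℚₚ.+-identityʳ _ ⟩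
  x Fin.zero                                            ∎
  where open ≡-Reasoning
finSum-identity {suc n} x (Fin.suc i) =
  trans (cong (_+ finSum (λ j → identity i j * x (Fin.suc j))) (ℚₚ.*-zeroˡ (x Fin.zero)))
        (trans (ℚₚ.+-identityˡ _) (finSum-identity (λ j → x (Fin.suc j)) i))

finSum-sumRange : ∀ n a (g : ℕ → ℚ) → finSum {n} (λ i → g (a ℕ.+ toℕ i)) ≡ sumRange g a n
finSum-sumRange zero    a g = refl
finSum-sumRange (suc n) a g =
  cong₂ _+_ (cong g (ℕₚ.+-identityʳ a))
            (trans (finSum-cong {n} {λ i → g (a ℕ.+ suc (toℕ i))} (λ i → cong g (ℕₚ.+-suc a (toℕ i))))
                   (finSum-sumRange n (suc a) g))

mulVec-shift-minus-one : ∀ {n} (M : Matrix n) x i → mulVec (shift M (- 1ℚ)) x i ≡ mulVec M x i + x i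
mulVec-shift-minus-one M x i = begin
  finSum (λ j → (M i j - (- 1ℚ) * identity i j) * x j)
    ≡⟨ finSum-cong (λ j → solve 3 (λ q d y → (q :- (:- con 1ℚ) :* d) :* y := q :* y :+ d :* y)
                                  refl (M i j) (identity i j) (x j)) ⟩
  finSum (λ j → M i j * x j + identity i j * x j)
    ≡⟨ finSum-+ (λ j → M i j * x j) (λ j → identity i j * x j) ⟩
  mulVec M x i + finSum (λ j → identity i j * x j)
    ≡⟨ cong (mulVec M x i +_) (finSum-identity x i) ⟩
  mulVec M x i + x i ∎
  where open ≡-Reasoning

extend : ∀ {n} → Vector n → ℕ → ℚ
extend {n} x l with l ℕ.<? n
... | yes l<n = x (fromℕ< l<n)
... | no  _   = 0ℚ

extend-toℕ : ∀ {n} (x : Vector n) i → extend x (toℕ i) ≡ x i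
extend-toℕ {n} x i with toℕ i ℕ.<? n
... | yes i<n = cong x (Finₚ.fromℕ<-toℕ i i<n)
... | no  i≮n = contradiction (Finₚ.toℕ<n i) i≮n

mulVec-sumRange : ∀ {n} (M : Matrix n) (f : ℕ → ℕ → ℚ) → (∀ i j → M i j ≡ f (toℕ i) (toℕ j)) →
                  ∀ x i → mulVec M x i ≡ sumRange (λ l → f (toℕ i) l * extend x l) 0 n
mulVec-sumRange {n} M f M≡f x i =
  trans (finSum-cong (λ j → cong₂ _*_ (M≡f i j) (sym (extend-toℕ x j))))
        (finSum-sumRange n 0 (λ l → f (toℕ i) l * extend x l))

∀Fin⇒∀< : ∀ {n} (P : ℕ → Set) → (∀ (i : Fin n) → P (toℕ i)) → ∀ {l} → l < n → P l
∀Fin⇒∀< P P-toℕ l<n = subst P (Finₚ.toℕ-fromℕ< l<n) (P-toℕ (fromℕ< l<n))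

≡-1*⇒+≡0 : ∀ {p q} → p ≡ - 1ℚ * q → p + q ≡ 0ℚ
≡-1*⇒+≡0 {q = q} refl = solve 1 (λ q → (:- con 1ℚ) :* q :+ q := con 0ℚ) refl q

+≡0⇒≡-1* : ∀ {p q} → p + q ≡ 0ℚ → p ≡ - 1ℚ * q
+≡0⇒≡-1* {p} {q} p+q≡0 = trans (inverseˡ-unique p q p+q≡0) (solve 1 (λ q → :- q := (:- con 1ℚ) :* q) refl q)

applyPow-sucʳ : ∀ {n} (M : Matrix n) r x → applyPow M (suc r) x ≡ applyPow M r (mulVec M x)
applyPow-sucʳ M zero    x = refl
applyPow-sucʳ M (suc r) x = cong (mulVec M) (applyPow-sucʳ M r x)

module Main (k : ℕ) (s t : Fin (suc k) → ℕ) (hs : ∀ j → 1 ≤ s j) (ht : ∀ j → 1 ≤ t j) where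

  nv : ℕ → ℕ
  nv j = blockSize (suc k) s t j ∸ 1

  open QuotientRows (2 ℕ.* k) (odd-2* k) nv

  Q : Matrix (2 ℕ.* suc k)
  Q = seidelQuotient (suc k) s t

  toℕ<m : ∀ (i : Fin (2 ℕ.* suc k)) → toℕ i < m
  toℕ<m i = subst (toℕ i <_) (ℕₚ.*-suc 2 k) (Finₚ.toℕ<n i)

  ∀Fin⇒∀<m : (P : ℕ → Set) → (∀ (i : Fin (2 ℕ.* suc k)) → P (toℕ i)) → ∀ {l} → l < m → P l
  ∀Fin⇒∀<m P P-toℕ {l} l<m = ∀Fin⇒∀< P P-toℕ (subst (l <_) (sym (ℕₚ.*-suc 2 k)) l<m)

  blockSize≡ : ∀ {j} → j < 2 ℕ.* suc k → blockSize (suc k) s t j ≡ suc (nv j)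
  blockSize≡ j<2k = sym (ℕₚ.m+[n∸m]≡n (blockSize-pos (suc k) s t hs ht _ j<2k))

  fromℤ-blockSize : ∀ b {j} → j < 2 ℕ.* suc k →
    fromℤ (negateIfℤ b (ℤ.+ blockSize (suc k) s t j)) ≡ negateIf b (fromℕ (suc (nv j)))
  fromℤ-blockSize b {j} j<2k =
    trans (fromℤ-negateIfℤ b (blockSize (suc k) s t j)) (cong (λ n → negateIf b (fromℕ n)) (blockSize≡ j<2k))

  Q≡quotientForm : ∀ i j → Q i j ≡ quotientForm nv (toℕ i) (toℕ j)
  Q≡quotientForm i j = entry (ℕₚ.<-cmp (toℕ i) (toℕ j))
    where
    pos = blockSize-pos (suc k) s t hs ht
    entry : Tri (toℕ i < toℕ j) (toℕ i ≡ toℕ j) (toℕ j < toℕ i) → Q i j ≡ quotientForm nv (toℕ i) (toℕ j)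
    entry (tri< i<j _ _) = trans (cong fromℤ (blockRowSum-< (suc k) s t pos i<j (Finₚ.toℕ<n j)))
                                 (trans (fromℤ-blockSize (odd (toℕ j)) (Finₚ.toℕ<n j)) (sym (quotientForm-< nv i<j)))
    entry (tri> _ _ j<i) = trans (cong fromℤ (blockRowSum-> (suc k) s t pos j<i (Finₚ.toℕ<n i)))
                                 (trans (fromℤ-blockSize (odd (toℕ i)) (Finₚ.toℕ<n j)) (sym (quotientForm-> nv j<i)))
    entry (tri≈ _ i≡j _) =
      subst (λ l → fromℤ (blockRowSum (suc k) s t (toℕ i) l) ≡ quotientForm nv (toℕ i) l) i≡j
        (trans (cong fromℤ (blockRowSum-diag (suc k) s t {toℕ i} (blockSize≡ (Finₚ.toℕ<n i))))
               (trans (fromℤ-negateIfℤ (odd (toℕ i)) (nv (toℕ i))) (sym (quotientForm-diag nv (toℕ i)))))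

  row-extend : ∀ x i → mulVec Q x i + x i ≡ row (extend x) (toℕ i)
  row-extend x i = cong₂ _+_
    (trans (mulVec-sumRange Q (quotientForm nv) Q≡quotientForm x i)
           (cong (sumRange (λ l → quotientForm nv (toℕ i) l * extend x l) 0) (ℕₚ.*-suc 2 k)))
    (sym (extend-toℕ x i))

  nv-last≡ : nv (suc (2 ℕ.* k)) ≡ t (Fin.fromℕ k) ∸ 1
  nv-last≡ = cong (_∸ 1) (blockSize-last k s t)

  rows≡0 : ∀ x → (∀ i → mulVec Q x i + x i ≡ 0ℚ) → ∀ {l} → l < m → row (extend x) l ≡ 0ℚ
  rows≡0 x Qx+x≡0 = ∀Fin⇒∀<m (λ l → row (extend x) l ≡ 0ℚ) (λ i → trans (sym (row-extend x i)) (Qx+x≡0 i))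

  no-eigenvalue : 1 < t (Fin.fromℕ k) → ¬ IsEigenvalue (- 1ℚ) Q
  no-eigenvalue 1<t (x , x≢0 , Qx≡-x) = x≢0 λ i →
    trans (sym (extend-toℕ x i))
          (Kernel.kernel-trivial (extend x) (rows≡0 x (λ i → ≡-1*⇒+≡0 (Qx≡-x i))) nv-last≡suc (toℕ<m i))
    where
    nv-last≡suc : nv (suc (2 ℕ.* k)) ≡ suc (t (Fin.fromℕ k) ∸ 2)
    nv-last≡suc = trans nv-last≡ (ℕₚ.+-∸-assoc 1 1<t)

  module _ (t≡1 : t (Fin.fromℕ k) ≡ 1) where
    open ≡-Reasoning

    private
      a = 2 ℕ.* k

    nv-last≡0 : nv (suc a) ≡ 0
    nv-last≡0 = trans nv-last≡ (cong (_∸ 1) t≡1)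

    v : Vector (2 ℕ.* suc k)
    v i = eigvec (toℕ i)

    Qv+v≡0 : ∀ i → mulVec Q v i + v i ≡ 0ℚ
    Qv+v≡0 i = begin
      mulVec Q v i + v i      ≡⟨ row-extend v i ⟩
      row (extend v) (toℕ i)  ≡⟨ row-cong (∀Fin⇒∀<m (λ l → extend v l ≡ eigvec l) (extend-toℕ v)) (toℕ<m i) ⟩
      row eigvec (toℕ i)      ≡⟨ eigvec-row≡0 nv-last≡0 (toℕ<m i) ⟩
      0ℚ                      ∎

    v≢0 : ¬ IsZeroVec v
    v≢0 v≡0 = ℚₚ.1≢0 (begin
      1ℚ                        ≡⟨ sym eigvec-a ⟩
      eigvec a                  ≡⟨ cong eigvec (sym (Finₚ.toℕ-fromℕ< a<2k)) ⟩
      v (fromℕ< a<2k)           ≡⟨ v≡0 (fromℕ< a<2k) ⟩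
      0ℚ                        ∎)
      where
      a<2k : a < 2 ℕ.* suc k
      a<2k = subst (a <_) (sym (ℕₚ.*-suc 2 k)) (ℕₚ.m<n⇒m<1+n (ℕₚ.n<1+n a))

    kernel⊆span : ∀ w → (∀ i → mulVec Q w i + w i ≡ 0ℚ) → ∀ i → w i ≡ extend w a * v i
    kernel⊆span w Qw+w≡0 i =
      trans (sym (extend-toℕ w i)) (Kernel.kernel-spanned (extend w) (rows≡0 w Qw+w≡0) (toℕ<m i))

    image∩span≡0 : ∀ w c → (∀ i → mulVec Q w i + w i ≡ c * v i) → c ≡ 0ℚ
    image∩span≡0 w c Qw+w≡cv = fromℕ-suc*x≡0⇒x≡0 (suc (nv a)) (begin
      fromℕ (suc (suc (nv a))) * c
        ≡⟨ cong (_* c) (fromℕ-suc (suc (nv a))) ⟩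
      (1ℚ + size a) * c
        ≡⟨ solve 2 (λ s c → (con 1ℚ :+ s) :* c := c :* con 1ℚ :+ c :* s) refl (size a) c ⟩
      c * 1ℚ + c * size a
        ≡⟨ cong₂ (λ e₁ e₂ → c * e₁ + c * e₂) (sym eigvec-a) (sym eigvec-b) ⟩
      c * eigvec a + c * eigvec (suc a)
        ≡⟨ sym (cong₂ _+_ (row≡c*eigvec (ℕₚ.m<n⇒m<1+n (ℕₚ.n<1+n a))) (row≡c*eigvec (ℕₚ.n<1+n (suc a)))) ⟩
      row (extend w) a + row (extend w) (suc a)
        ≡⟨ row-a+row-last≡0 nv-last≡0 (extend w) ⟩
      0ℚ ∎)
      where
      row≡c*eigvec : ∀ {l} → l < m → row (extend w) l ≡ c * eigvec l
      row≡c*eigvec = ∀Fin⇒∀<m (λ l → row (extend w) l ≡ c * eigvec l)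
                              (λ i → trans (sym (row-extend w i)) (Qw+w≡cv i))

    generalized-eigenvector : ∀ r w → IsZeroVec (applyPow (shift Q (- 1ℚ)) r w) →
                              Σ ℚ λ c → ∀ i → w i ≡ c * v i
    generalized-eigenvector zero    w w≡0     = 0ℚ , λ i → trans (w≡0 i) (sym (ℚₚ.*-zeroˡ (v i)))
    generalized-eigenvector (suc r) w Mʳ⁺¹w≡0 = extend w a , kernel⊆span w Qw+w≡0
      where
      M = shift Q (- 1ℚ)
      ih = generalized-eigenvector r (mulVec M w)
             (λ i → trans (cong (λ u → u i) (sym (applyPow-sucʳ M r w))) (Mʳ⁺¹w≡0 i))
      Qw+w≡cv : ∀ i → mulVec Q w i + w i ≡ proj₁ ih * v i
      Qw+w≡cv i = trans (sym (mulVec-shift-minus-one Q w i)) (proj₂ ih i)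
      Qw+w≡0 : ∀ i → mulVec Q w i + w i ≡ 0ℚ
      Qw+w≡0 i = trans (Qw+w≡cv i)
                       (trans (cong (_* v i) (image∩span≡0 w (proj₁ ih) Qw+w≡cv)) (ℚₚ.*-zeroˡ (v i)))

    simple-eigenvalue : IsSimpleEigenvalue (- 1ℚ) Q
    simple-eigenvalue = v , v≢0 , (λ i → +≡0⇒≡-1* (Qv+v≡0 i)) , generalized-eigenvector (2 ℕ.* suc k)

mainTheorem3 : (k : ℕ) (hk : 1 ≤ k) (s t : Fin k → ℕ) →
    (∀ j → 1 ≤ s j) → (∀ j → 1 ≤ t j) →
    (t (lastIdx k hk) ≡ 1 → IsSimpleEigenvalue (- 1ℚ) (seidelQuotient k s t)) ×
    (1 < t (lastIdx k hk) → ¬ IsEigenvalue (- 1ℚ) (seidelQuotient k s t))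
mainTheorem3 zero    ()
mainTheorem3 (suc k) _  s t hs ht = Main.simple-eigenvalue k s t hs ht , Main.no-eigenvalue k s t hs ht
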